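{- Let $\mathcal{F}=\langle W,R,\{S_x\}_{x\in W}\rangle$ be a Veltman frame, $f$ an ultrafilter on $W$, and $l$ a proper filter on $W$. Let $B_f$ be the set of all $A\subseteq W$ for which there is a finite (possibly empty) family $S_1,\dots,S_n\in l$ with $S^{ -1}(\overline{A},\overline{S_1}\cup\dots\cup\overline{S_n})\in f$. Then $B_f$ is closed under intersections: if $C,D\in B_f$ then $C\cap D\in B_f$.
   Context: A Veltman frame is $\langle W,R,\{S_w\}\rangle$ where: - $W$ is nonempty. - $R$ is transitive and conversely well-founded. - Each $S_w$ is a reflexive transitive relation on $R[w]=\{v:wRv\}$ containing $R\cap R[w]^2$. For $X,Y\subseteq W$: - $\overline{Y}=W\setminus Y$. - $S^{ -1}(X,Y)=\{w:\forall x\in X(wRx\to\exists y\in Y\,xS_wy)\}$. A proper filter is a filter not containing $\emptyset$. -}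

module Defs where

open import Level using (0ℓ)
open import Data.Product using (Σ; _×_; _,_)
open import Data.Sum using (_⊎_)
open import Data.Empty using (⊥)
open import Data.Nat using (ℕ)
open import Data.Fin using (Fin)
open import Relation.Nullary using (¬_)
open import Induction.WellFounded using (WellFounded)

Subset : Set → Set₁
Subset W = W → Set

module _ {W : Set} where
  _⊆_ : Subset W → Subset W → Set
  X ⊆ Y = ∀ x → X x → Y x

  _∩_ : Subset W → Subset W → Subset W
  (X ∩ Y) x = X x × Y x

  ∁ : Subset W → Subset W
  ∁ X x = ¬ X x

  ∅ : Subset W
  ∅ _ = ⊥

  Full : Subset W
  Full _ = W

  ⋃∁ : {n : ℕ} → (Fin n → Subset W) → Subset W
  ⋃∁ {n} Ss x = Σ (Fin n) λ i → ¬ Ss i x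

-- A Veltman frame ⟨W,R,{S_w}⟩; S w x y means x S_w y.
record VeltmanFrame : Set₁ where
  field
    W : Set
    R : W → W → Set
    S : W → W → W → Set
    nonempty : W
    R-trans : ∀ {x y z} → R x y → R y z → R x z
    R-cwf : WellFounded (λ x y → R y x)
    S-dom : ∀ {w x y} → S w x y → R w x × R w y
    S-refl : ∀ {w x} → R w x → S w x x
    S-trans : ∀ {w x y z} → S w x y → S w y z → S w x z
    R⊆S : ∀ {w x y} → R w x → R w y → R x y → S w x y

  Sinv : Subset W → Subset W → Subset W
  Sinv X Y w = ∀ x → X x → R w x → Σ W λ y → Y y × S w x y

Family : Set → Set₁
Family W = Subset W → Set

record IsFilter {W : Set} (F : Family W) : Set₁ where
  field
    full : F Full
    up : ∀ {X Y} → X ⊆ Y → F X → F Y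
    meet : ∀ {X Y} → F X → F Y → F (X ∩ Y)

record IsProperFilter {W : Set} (F : Family W) : Set₁ where
  field
    filter : IsFilter F
    proper : ¬ F ∅

record IsUltrafilter {W : Set} (F : Family W) : Set₁ where
  field
    properFilter : IsProperFilter F
    ultra : ∀ X → F X ⊎ F (∁ X)

module _ (𝔉 : VeltmanFrame) where
  open VeltmanFrame 𝔉
  B : (f l : Family W) → Subset W → Set₁
  B f l A = Σ ℕ λ n → Σ (Fin n → Subset W) λ Ss →
    (∀ i → l (Ss i)) × f (Sinv (∁ A) (⋃∁ Ss))

{-# OPTIONS --safe #-}

-- Constructively, a point outside C ∩ D need not be known to lie outside C or
-- outside D.  But an ultrafilter decides the constant subsets λ _ → P, which
-- yields weak excluded middle and hence that De Morgan law.  Then the witnesses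
-- for C and D combine: concatenate the two finite families from l and
-- intersect the two members of f.
module Submission where

open import Defs
open import Data.Nat using (_+_)
open import Data.Fin using (splitAt; _↑ˡ_; _↑ʳ_)
open import Data.Vec.Functional using (Vector; _++_)
open import Data.Vec.Functional.Properties using (lookup-++ˡ; lookup-++ʳ)
open import Data.Vec.Functional.Relation.Unary.All using (All)
open import Data.Product using (_×_; _,_)
open import Data.Sum using (_⊎_; inj₁; inj₂)
open import Relation.Nullary using (¬_)
open import Relation.Unary using (Pred)
open import Relation.Binary.PropositionalEquality using (subst; sym)

WeakExcludedMiddle : Set₁
WeakExcludedMiddle = (P : Set) → ¬ P ⊎ ¬ ¬ P

wem⇒¬×⇒¬⊎¬ : WeakExcludedMiddle → {P Q : Set} → ¬ (P × Q) → ¬ P ⊎ ¬ Q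
wem⇒¬×⇒¬⊎¬ wem {P} ¬p×q with wem P
... | inj₁ ¬p  = inj₁ ¬p
... | inj₂ ¬¬p = inj₂ λ q → ¬¬p λ p → ¬p×q (p , q)

ultrafilter⇒wem : {W : Set} {F : Family W} → IsUltrafilter F → WeakExcludedMiddle
ultrafilter⇒wem {F = F} F-ultra P = decide (ultra (λ _ → P))
  where
  open IsUltrafilter F-ultra
  open IsProperFilter properFilter
  open IsFilter filter

  decide : F (λ _ → P) ⊎ F (∁ (λ _ → P)) → ¬ P ⊎ ¬ ¬ P
  decide (inj₁ P∈F)  = inj₂ λ ¬p → proper (up (λ _ p → ¬p p) P∈F)
  decide (inj₂ ¬P∈F) = inj₁ λ p → proper (up (λ _ ¬p → ¬p p) ¬P∈F)

All-++⁺ : ∀ {a p} {A : Set a} {P : Pred A p} {m n} {xs : Vector A m} {ys : Vector A n} →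
          All P xs → All P ys → All P (xs ++ ys)
All-++⁺ {m = m} pxs pys i with splitAt m i
... | inj₁ j = pxs j
... | inj₂ j = pys j

module _ {W : Set} where

  ⋃∁-++ˡ : ∀ {m n} (Ss : Vector (Subset W) m) (Ts : Vector (Subset W) n) → ⋃∁ Ss ⊆ ⋃∁ (Ss ++ Ts)
  ⋃∁-++ˡ {n = n} Ss Ts x (i , x∉Sᵢ) =
    i ↑ˡ n , subst (λ S → ¬ S x) (sym (lookup-++ˡ Ss Ts i)) x∉Sᵢ

  ⋃∁-++ʳ : ∀ {m n} (Ss : Vector (Subset W) m) (Ts : Vector (Subset W) n) → ⋃∁ Ts ⊆ ⋃∁ (Ss ++ Ts)
  ⋃∁-++ʳ {m = m} Ss Ts x (i , x∉Tᵢ) =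
    m ↑ʳ i , subst (λ S → ¬ S x) (sym (lookup-++ʳ Ss Ts i)) x∉Tᵢ

module _ (𝔉 : VeltmanFrame) where
  open VeltmanFrame 𝔉

  Sinv-monoʳ : ∀ {X Y Y′} → Y ⊆ Y′ → Sinv X Y ⊆ Sinv X Y′
  Sinv-monoʳ Y⊆Y′ w h x x∈X wRx with h x x∈X wRx
  ... | y , y∈Y , xSy = y , Y⊆Y′ y y∈Y , xSy

  Sinv-cover : ∀ {X X₁ X₂ Y} → (∀ x → X x → X₁ x ⊎ X₂ x) → (Sinv X₁ Y ∩ Sinv X₂ Y) ⊆ Sinv X Y
  Sinv-cover cover w (h₁ , h₂) x x∈X with cover x x∈X
  ... | inj₁ x∈X₁ = h₁ x x∈X₁
  ... | inj₂ x∈X₂ = h₂ x x∈X₂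

lemma5p7 : (𝔉 : VeltmanFrame) (f l : Family (VeltmanFrame.W 𝔉)) → IsUltrafilter f → IsProperFilter l → (C D : Subset (VeltmanFrame.W 𝔉)) → B 𝔉 f l C → B 𝔉 f l D → B 𝔉 f l (C ∩ D)
lemma5p7 𝔉 f l f-ultra _ C D (m , Ss , Ss∈l , C-wit) (n , Ts , Ts∈l , D-wit) =
  m + n , Ss ++ Ts , All-++⁺ {P = l} Ss∈l Ts∈l , up combine (meet C-wit D-wit)
  where
  open VeltmanFrame 𝔉
  open IsFilter (IsProperFilter.filter (IsUltrafilter.properFilter f-ultra))

  combine : (Sinv (∁ C) (⋃∁ Ss) ∩ Sinv (∁ D) (⋃∁ Ts)) ⊆ Sinv (∁ (C ∩ D)) (⋃∁ (Ss ++ Ts))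
  combine w (hC , hD) =
    Sinv-cover 𝔉 (λ _ → wem⇒¬×⇒¬⊎¬ (ultrafilter⇒wem f-ultra)) w
      (Sinv-monoʳ 𝔉 (⋃∁-++ˡ Ss Ts) w hC , Sinv-monoʳ 𝔉 (⋃∁-++ʳ Ss Ts) w hD)
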